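{- Let $N\ge 2$, $M=\binom{N}{2}$, and let $(m_1,n_1),\dots,(m_M,n_M)$ be the pairs $(m,n)$ with $1\le m<n\le N$ listed in lexicographic order. Given $\psi=(\psi_1,\dots,\psi_M)\in\Psi^M$, call an $N$-tuple $(x_1,\dots,x_N)$ of pairwise distinct rational numbers a solution for $\psi$ if $x_{m_k}+x_{n_k}=\psi_k$ for all $1\le k\le M$. (For such a solution the points $(x_i,x_i^2)$ form an $N$-point rational distance set on $y=x^2$.) <br>(1) If $N=2$, then for every $\psi_1\in\Psi$ there are infinitely many solutions $(x_1,x_2)$ for $\psi_1$. <br>(2) If $N=3$, then for every $(\psi_1,\psi_2,\psi_3)\in\Psi^3$ satisfying the Distinct Coordinates condition there is exactly one solution, namely $x_1=\tfrac12(\psi_1+\psi_2-\psi_3)$, $x_2=\tfrac12(\psi_1-\psi_2+\psi_3)$, $x_3=\tfrac12(-\psi_1+\psi_2+\psi_3)$. <br>(3) If $N\ge 4$, then for $\psi\in\Psi^M$ a solution exists if and only if $\psi$ satisfies both the Distinct Coordinates condition and the Existence Condition; in that case the solution is unique and is given by $x_1=\tfrac12(\psi_1+\psi_2-\psi_N)$, $x_2=\tfrac12(\psi_1-\psi_2+\psi_N)$, $x_3=\tfrac12(-\psi_1+\psi_2+\psi_N)$, and $x_i=\tfrac12(-\psi_1-\psi_2+2\psi_{i-1}+\psi_N)$ for $4\le i\le N$.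
   Context: A Pythagorean triplet is a triple $(\alpha,\beta,\gamma)$ of nonzero integers with $\alpha^2+\beta^2=\gamma^2$, $\gamma>0$; its Pythagorean ratio is $\beta/\alpha$, and $0$ is also counted as a Pythagorean ratio. $\Psi$ denotes the set of all Pythagorean ratios. A rational distance set $\mathrm{RDS}(N)$ on $y=x^2$ is a set of $N$ points on the parabola with rational coordinates and all pairwise distances rational. In the lexicographic order of pairs, $\psi_k$ for $1\le k\le N-1$ is attached to the pair $(1,k+1)$ and $\psi_N$ to the pair $(2,3)$. <br>Distinct Coordinates condition (for $N\ge3$): $\psi_1\ne\psi_2$, $\psi_1\ne\psi_N$, $\psi_2\ne\psi_N$; $\psi_{i-1}\ne\psi_{j-1}$ for all $4\le i<j\le N$; and for all $4\le j\le N$: $\psi_1\ne\psi_{j-1}$, $\psi_2\ne\psi_{j-1}$, $\psi_1+\psi_2\ne\psi_{j-1}+\psi_N$. (This is equivalent to the $x_i$ given by the displayed formulas being pairwise distinct.) <br>Existence Condition (for $N\ge4$): for $1\le i\le N-3$, $\psi_2+\psi_{N+i}=\psi_N+\psi_{i+2}$; for $N-2\le i\le 2N-6$, $\psi_1+\psi_{N+i}=\psi_N+\psi_{i+5-N}$; for $2N-5\le i\le M-N$, $\psi_1+\psi_2+\psi_{N+i}=\psi_N+\psi_{m'_t+2}+\psi_{n'_t+2}$ where $t=i+6-2N$ and $(m'_t,n'_t)$ is the $t$-th pair in the lexicographic list of pairs $(m,n)$ with $1\le m<n\le N-3$. -}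

module Defs where

open import Data.Nat as ℕ using (ℕ; zero; suc; _≤_; _<_; _∸_)
open import Data.Nat.Combinatorics using (_C_)
open import Data.Integer as ℤ using (ℤ; 0ℤ)
open import Data.Rational as ℚ using (ℚ; 0ℚ; ½; _÷_; _+_; _-_; -_; _*_)
open import Relation.Nullary using (yes; no; ¬_)
open import Data.Fin using (Fin; toℕ)
open import Data.Vec using (Vec; lookup; tabulate)
open import Data.List using (List; []; _∷_; applyUpTo; concatMap; map)
open import Data.Product using (_×_; _,_; Σ; ∃; proj₁; proj₂)
open import Data.Sum using (_⊎_)
open import Relation.Binary.PropositionalEquality using (_≡_; _≢_)

fromℤ : ℤ → ℚ
fromℤ z = z ℚ./ 1

IsPythagoreanTriplet : ℤ → ℤ → ℤ → Set
IsPythagoreanTriplet α β γ =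
  α ≢ 0ℤ × β ≢ 0ℤ × γ ≢ 0ℤ ×
  (α ℤ.* α ℤ.+ β ℤ.* β ≡ γ ℤ.* γ) × (0ℤ ℤ.< γ)

InΨ : ℚ → Set
InΨ q =
  q ≡ 0ℚ ⊎
  Σ ℤ λ α → Σ ℤ λ β → Σ ℤ λ γ → IsPythagoreanTriplet α β γ ×
    Σ (ℚ.NonZero (fromℤ α)) λ nz → q ≡ (fromℤ β ÷ fromℤ α) {{nz}}

-- 1-based access into lists / vectors (default value outside range;
-- all accesses used below are in range)

_!ℓ_ : {A : Set} → List A → ℕ → A → A
([] !ℓ k) d = d
((a ∷ as) !ℓ zero) d = d
((a ∷ as) !ℓ suc zero) d = a
((a ∷ as) !ℓ suc (suc k)) d = (as !ℓ suc k) d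

_!_ : {n : ℕ} → Vec ℚ n → ℕ → ℚ
_!_ {n} v zero = 0ℚ
_!_ {n} v (suc k) with k ℕ.<? n
... | yes k<n = lookup v (Data.Fin.fromℕ< k<n)
... | no _ = 0ℚ

lexPairs : ℕ → List (ℕ × ℕ)
lexPairs N = concatMap (λ m → map (λ n → (m , n)) (applyUpTo (λ j → m ℕ.+ suc j) (N ∸ m)))
                       (applyUpTo suc N)

-- (m_k , n_k), 1-based k
pairAt : ℕ → ℕ → ℕ × ℕ
pairAt N k = (lexPairs N !ℓ k) (0 , 0)

AllInΨ : {M : ℕ} → Vec ℚ M → Set
AllInΨ {M} ψ = (k : Fin M) → InΨ (lookup ψ k)

IsSolution : (N : ℕ) → Vec ℚ (N C 2) → Vec ℚ N → Set
IsSolution N ψ x =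
  ((i j : Fin N) → i ≢ j → lookup x i ≢ lookup x j) ×
  ((k : ℕ) → 1 ≤ k → k ≤ N C 2 →
     x ! proj₁ (pairAt N k) + x ! proj₂ (pairAt N k) ≡ ψ ! k)

DistinctCoordinates : (N : ℕ) → Vec ℚ (N C 2) → Set
DistinctCoordinates N ψ =
  (ψ ! 1 ≢ ψ ! 2) × (ψ ! 1 ≢ ψ ! N) × (ψ ! 2 ≢ ψ ! N) ×
  ((i j : ℕ) → 4 ≤ i → i < j → j ≤ N → ψ ! (i ∸ 1) ≢ ψ ! (j ∸ 1)) ×
  ((j : ℕ) → 4 ≤ j → j ≤ N →
     (ψ ! 1 ≢ ψ ! (j ∸ 1)) × (ψ ! 2 ≢ ψ ! (j ∸ 1)) ×
     (ψ ! 1 + ψ ! 2 ≢ ψ ! (j ∸ 1) + ψ ! N))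

ExistenceCondition : (N : ℕ) → Vec ℚ (N C 2) → Set
ExistenceCondition N ψ =
  ((i : ℕ) → 1 ≤ i → i ≤ N ∸ 3 →
     ψ ! 2 + ψ ! (N ℕ.+ i) ≡ ψ ! N + ψ ! (i ℕ.+ 2)) ×
  ((i : ℕ) → N ∸ 2 ≤ i → i ≤ 2 ℕ.* N ∸ 6 →
     ψ ! 1 + ψ ! (N ℕ.+ i) ≡ ψ ! N + ψ ! (i ℕ.+ 5 ∸ N)) ×
  ((i : ℕ) → 2 ℕ.* N ∸ 5 ≤ i → i ≤ N C 2 ∸ N →
     let t = i ℕ.+ 6 ∸ 2 ℕ.* N
         m' = proj₁ (pairAt (N ∸ 3) t)
         n' = proj₂ (pairAt (N ∸ 3) t)
     in ψ ! 1 + ψ ! 2 + ψ ! (N ℕ.+ i) ≡ ψ ! N + ψ ! (m' ℕ.+ 2) + ψ ! (n' ℕ.+ 2))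

xFormula : (N : ℕ) → Vec ℚ (N C 2) → ℕ → ℚ
xFormula N ψ 1 = ½ * (ψ ! 1 + ψ ! 2 - ψ ! N)
xFormula N ψ 2 = ½ * (ψ ! 1 - ψ ! 2 + ψ ! N)
xFormula N ψ 3 = ½ * (- ψ ! 1 + ψ ! 2 + ψ ! N)
xFormula N ψ i = ½ * (- ψ ! 1 - ψ ! 2 + (ψ ! (i ∸ 1) + ψ ! (i ∸ 1)) + ψ ! N)

formulaVec : (N : ℕ) → Vec ℚ (N C 2) → Vec ℚ N
formulaVec N ψ = tabulate (λ i → xFormula N ψ (suc (toℕ i)))

-- With x_i + x_j = ψ_k written for the k-th lexicographic pair (i, j), the equations for the
-- pairs (1, 2), (1, 3), (2, 3) and (1, j), j ≥ 4, form a connected graph with one odd cycle, so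
-- they determine x: adding and subtracting them gives the displayed formulas. Given these core
-- equations, every other pair equation x_a + x_b = ψ_k becomes equivalent to a linear relation
-- among the ψ's alone, and these relations are precisely the clauses of the Existence Condition.
-- Similarly each coincidence x_a = x_b amounts to an equality among the ψ's excluded by the
-- Distinct Coordinates condition. For N = 2 the only equation is x₁ + x₂ = ψ₁, and x₁ may be
-- chosen beyond every first coordinate of a given finite list.

{-# OPTIONS --safe #-}
module Submission where

open import Defs
open import Data.Nat as ℕ using (ℕ; zero; suc; _≤_; _<_; _∸_; s≤s; z≤n; s≤s⁻¹)
import Data.Nat.Properties as ℕₚ
open import Data.Nat.Tactic.RingSolver using (solve-∀)
open import Data.Nat.Combinatorics using (_C_; nCk+nC[k+1]≡[n+1]C[k+1]; nC1≡n)
open import Data.List using (List; []; _∷_; _++_; applyUpTo; concatMap; map; length; foldr)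
open import Data.List.Membership.Propositional using (_∈_; _∉_)
open import Data.List.Relation.Unary.Any using (here; there)
open import Data.List.Properties
  using (map-∘; map-applyUpTo; concatMap-map; concatMap-cong; map-concatMap; length-++; length-map; length-applyUpTo)
open import Data.Product using (_×_; _,_; proj₁; proj₂; Σ; ∃)
open import Function using (_∘_)
open import Data.Rational as ℚ using (ℚ; ½; 0ℚ; 1ℚ; _+_; _-_; -_; _*_; _⊔_)
import Data.Rational.Properties as ℚₚ
open import Data.Rational.Solver using (module +-*-Solver)
open import Algebra.Properties.Group ℚₚ.+-0-group using (∙-cancelˡ)
open import Data.Fin as Fin using (Fin; toℕ; fromℕ<)
open import Data.Fin.Properties using (toℕ<n; fromℕ<-toℕ; toℕ-fromℕ<; fromℕ<-injective; toℕ-injective)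
open import Data.Vec using (Vec; lookup; tabulate; _∷_; [])
open import Data.Vec.Properties using (lookup∘tabulate; tabulate∘lookup; tabulate-cong)
open import Function.Bundles using (_⇔_; mk⇔; module Equivalence)
open Equivalence using (to; from)
open import Relation.Binary.PropositionalEquality
open import Relation.Nullary using (yes; no; contradiction)
open import Relation.Binary.Definitions using (tri<; tri≈; tri>)
open +-*-Solver using (solve; _:+_; _:-_; :-_; _:*_; _:=_)

shift : ℕ × ℕ → ℕ × ℕ
shift (m , n) = suc m , suc n

lexRow : ℕ → ℕ → List (ℕ × ℕ)
lexRow N m = map (m ,_) (applyUpTo (λ j → m ℕ.+ suc j) (N ∸ m))

firstRow : ℕ → List (ℕ × ℕ)
firstRow N = lexRow (suc N) 1

lexRow-suc : ∀ N m → lexRow (suc N) (suc m) ≡ map shift (lexRow N m)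
lexRow-suc N m =
  trans (map-applyUpTo _ _ (N ∸ m)) (sym (trans (sym (map-∘ (applyUpTo _ (N ∸ m)))) (map-applyUpTo _ _ (N ∸ m))))

lexPairs-suc : ∀ N → lexPairs (suc N) ≡ firstRow N ++ map shift (lexPairs N)
lexPairs-suc N = cong (firstRow N ++_) (begin
  concatMap (lexRow (suc N)) (applyUpTo (suc ∘ suc) N)     ≡⟨ cong (concatMap _) (sym (map-applyUpTo suc suc N)) ⟩
  concatMap (lexRow (suc N)) (map suc (applyUpTo suc N))   ≡⟨ concatMap-map (lexRow (suc N)) suc (applyUpTo suc N) ⟩
  concatMap (lexRow (suc N) ∘ suc) (applyUpTo suc N)       ≡⟨ concatMap-cong (lexRow-suc N) (applyUpTo suc N) ⟩
  concatMap (map shift ∘ lexRow N) (applyUpTo suc N)       ≡⟨ map-concatMap shift (lexRow N) (applyUpTo suc N) ⟨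
  map shift (lexPairs N)                                   ∎)
  where open ≡-Reasoning

length-firstRow : ∀ N → length (firstRow N) ≡ N
length-firstRow N = trans (length-map _ (applyUpTo _ N)) (length-applyUpTo _ N)

suc-C2 : ∀ n → suc n C 2 ≡ n ℕ.+ n C 2
suc-C2 n = trans (sym (nCk+nC[k+1]≡[n+1]C[k+1] n 1)) (cong (ℕ._+ n C 2) (nC1≡n n))

length-lexPairs : ∀ N → length (lexPairs N) ≡ N C 2
length-lexPairs zero = refl
length-lexPairs (suc N) = begin
  length (lexPairs (suc N))                         ≡⟨ cong length (lexPairs-suc N) ⟩
  length (firstRow N ++ map shift (lexPairs N))     ≡⟨ length-++ (firstRow N) ⟩
  length (firstRow N) ℕ.+ length (map shift (lexPairs N))
    ≡⟨ cong₂ ℕ._+_ (length-firstRow N) (trans (length-map shift (lexPairs N)) (length-lexPairs N)) ⟩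
  N ℕ.+ N C 2                                       ≡⟨ suc-C2 N ⟨
  suc N C 2                                         ∎
  where open ≡-Reasoning

module _ {A : Set} where

  !ℓ-++ˡ : ∀ (xs ys : List A) {k} d → k < length xs → ((xs ++ ys) !ℓ suc k) d ≡ (xs !ℓ suc k) d
  !ℓ-++ˡ (x ∷ xs) ys {zero}  d _         = refl
  !ℓ-++ˡ (x ∷ xs) ys {suc k} d (s≤s k<n) = !ℓ-++ˡ xs ys d k<n

  !ℓ-++ʳ : ∀ (xs ys : List A) k d → ((xs ++ ys) !ℓ suc (length xs ℕ.+ k)) d ≡ (ys !ℓ suc k) d
  !ℓ-++ʳ []       ys k d = refl
  !ℓ-++ʳ (x ∷ xs) ys k d = !ℓ-++ʳ xs ys k d

  !ℓ-applyUpTo : ∀ (f : ℕ → A) {n k} d → k < n → (applyUpTo f n !ℓ suc k) d ≡ f k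
  !ℓ-applyUpTo f {suc n} {zero}  d _         = refl
  !ℓ-applyUpTo f {suc n} {suc k} d (s≤s k<n) = !ℓ-applyUpTo (f ∘ suc) d k<n

!ℓ-map : ∀ {A B : Set} (f : A → B) (xs : List A) {k} d d′ → k < length xs →
         (map f xs !ℓ suc k) d ≡ f ((xs !ℓ suc k) d′)
!ℓ-map f (x ∷ xs) {zero}  d d′ _         = refl
!ℓ-map f (x ∷ xs) {suc k} d d′ (s≤s k<n) = !ℓ-map f xs d d′ k<n

pairAt-firstRow : ∀ N {k} → k < N → pairAt (suc N) (suc k) ≡ (1 , 2 ℕ.+ k)
pairAt-firstRow N {k} k<N = begin
  (lexPairs (suc N) !ℓ suc k) (0 , 0)                       ≡⟨ cong (λ ps → (ps !ℓ suc k) (0 , 0)) (lexPairs-suc N) ⟩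
  ((firstRow N ++ map shift (lexPairs N)) !ℓ suc k) (0 , 0) ≡⟨ !ℓ-++ˡ (firstRow N) _ _ (subst (k <_) (sym (length-firstRow N)) k<N) ⟩
  (firstRow N !ℓ suc k) (0 , 0)                             ≡⟨ !ℓ-map (1 ,_) (applyUpTo _ N) _ 0 (subst (k <_) (sym (length-applyUpTo _ N)) k<N) ⟩
  (1 , (applyUpTo (λ j → 2 ℕ.+ j) N !ℓ suc k) 0)            ≡⟨ cong (1 ,_) (!ℓ-applyUpTo _ 0 k<N) ⟩
  (1 , 2 ℕ.+ k)                                             ∎
  where open ≡-Reasoning

pairAt-laterRows : ∀ N {k} → k < N C 2 → pairAt (suc N) (suc (N ℕ.+ k)) ≡ shift (pairAt N (suc k))
pairAt-laterRows N {k} k<M = begin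
  (lexPairs (suc N) !ℓ suc (N ℕ.+ k)) (0 , 0)
    ≡⟨ cong₂ (λ ps m → (ps !ℓ suc (m ℕ.+ k)) (0 , 0)) (lexPairs-suc N) (sym (length-firstRow N)) ⟩
  ((firstRow N ++ map shift (lexPairs N)) !ℓ suc (length (firstRow N) ℕ.+ k)) (0 , 0)
    ≡⟨ !ℓ-++ʳ (firstRow N) _ k _ ⟩
  (map shift (lexPairs N) !ℓ suc k) (0 , 0)
    ≡⟨ !ℓ-map shift (lexPairs N) _ _ (subst (k <_) (sym (length-lexPairs N)) k<M) ⟩
  shift (pairAt N (suc k))
    ∎
  where open ≡-Reasoning

data LexIndex (N : ℕ) : ℕ → Set where
  inFirstRow  : ∀ {k} → k < N → LexIndex N k
  inLaterRows : ∀ {k} → k < N C 2 → LexIndex N (N ℕ.+ k)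

lexIndex : ∀ N {k} → k < suc N C 2 → LexIndex N k
lexIndex N {k} k<M with k ℕₚ.<? N
... | yes k<N = inFirstRow k<N
... | no k≮N  = subst (LexIndex N) N+[k∸N]≡k (inLaterRows k∸N<M)
  where
  N+[k∸N]≡k : N ℕ.+ (k ∸ N) ≡ k
  N+[k∸N]≡k = ℕₚ.m+[n∸m]≡n (ℕₚ.≮⇒≥ k≮N)
  k∸N<M : k ∸ N < N C 2
  k∸N<M = ℕₚ.+-cancelˡ-< N (k ∸ N) (N C 2) (subst₂ _<_ (sym N+[k∸N]≡k) (suc-C2 N) k<M)

firstRow-bound : ∀ N {k} → k < N → k < suc N C 2
firstRow-bound N {k} k<N = subst (k <_) (sym (suc-C2 N)) (ℕₚ.m≤n⇒m≤n+o (N C 2) k<N)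

laterRows-bound : ∀ N {k} → k < N C 2 → N ℕ.+ k < suc N C 2
laterRows-bound N {k} k<M = subst (N ℕ.+ k <_) (sym (suc-C2 N)) (ℕₚ.+-monoʳ-< N k<M)

IsPair : ℕ → ℕ × ℕ → Set
IsPair N (a , b) = 1 ≤ a × a < b × b ≤ N

pairAt-isPair : ∀ N {k} → k < N C 2 → IsPair N (pairAt N (suc k))
pairAt-isPair (suc N) k<M with lexIndex N k<M
... | inFirstRow k<N rewrite pairAt-firstRow N k<N = s≤s z≤n , s≤s (s≤s z≤n) , s≤s k<N
... | inLaterRows k<M′ rewrite pairAt-laterRows N k<M′ with pairAt-isPair N k<M′
...   | 1≤a , a<b , b≤N = s≤s z≤n , s≤s a<b , s≤s b≤N

-- For N = 3 + n the lexicographic list consists of the pairs (1, j), then (2, j), then (3, j),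
-- and finally lexPairs n shifted by 3; the index of a block is a 0-based position in the list.
data Block (n : ℕ) : ℕ → Set where
  row₁  : ∀ {k} → k < 2 ℕ.+ n → Block n k
  row₂  : ∀ {k} → k < 1 ℕ.+ n → Block n ((2 ℕ.+ n) ℕ.+ k)
  row₃  : ∀ {k} → k < n → Block n ((2 ℕ.+ n) ℕ.+ ((1 ℕ.+ n) ℕ.+ k))
  inner : ∀ {t} → t < n C 2 → Block n ((2 ℕ.+ n) ℕ.+ ((1 ℕ.+ n) ℕ.+ (n ℕ.+ t)))

block : ∀ n {k} → k < (3 ℕ.+ n) C 2 → Block n k
block n k<M with lexIndex (2 ℕ.+ n) k<M
... | inFirstRow k<N = row₁ k<N
... | inLaterRows k<M₁ with lexIndex (1 ℕ.+ n) k<M₁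
...   | inFirstRow k<N = row₂ k<N
...   | inLaterRows k<M₂ with lexIndex n k<M₂
...     | inFirstRow k<N = row₃ k<N
...     | inLaterRows k<M₃ = inner k<M₃

blockPair : ∀ {n k} → Block n k → ℕ × ℕ
blockPair (row₁ {k} _)  = 1 , 2 ℕ.+ k
blockPair (row₂ {k} _)  = 2 , 3 ℕ.+ k
blockPair (row₃ {k} _)  = 3 , 4 ℕ.+ k
blockPair {n} (inner {t} _) = shift (shift (shift (pairAt n (suc t))))

pairAt-block : ∀ {n k} (b : Block n k) → pairAt (3 ℕ.+ n) (suc k) ≡ blockPair b
pairAt-block {n} (row₁ k<N) = pairAt-firstRow (2 ℕ.+ n) k<N
pairAt-block {n} (row₂ k<N) =
  trans (pairAt-laterRows (2 ℕ.+ n) (firstRow-bound (1 ℕ.+ n) k<N)) (cong shift (pairAt-firstRow (1 ℕ.+ n) k<N))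
pairAt-block {n} (row₃ k<N) =
  trans (pairAt-laterRows (2 ℕ.+ n) (laterRows-bound (1 ℕ.+ n) (firstRow-bound n k<N)))
        (cong shift (trans (pairAt-laterRows (1 ℕ.+ n) (firstRow-bound n k<N)) (cong shift (pairAt-firstRow n k<N))))
pairAt-block {n} (inner t<M) =
  trans (pairAt-laterRows (2 ℕ.+ n) (laterRows-bound (1 ℕ.+ n) (laterRows-bound n t<M)))
        (cong shift (trans (pairAt-laterRows (1 ℕ.+ n) (laterRows-bound n t<M)) (cong shift (pairAt-laterRows n t<M))))

block-bound : ∀ {n k} → Block n k → k < (3 ℕ.+ n) C 2
block-bound {n} (row₁ k<N)  = firstRow-bound (2 ℕ.+ n) k<N
block-bound {n} (row₂ k<N)  = laterRows-bound (2 ℕ.+ n) (firstRow-bound (1 ℕ.+ n) k<N)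
block-bound {n} (row₃ k<N)  = laterRows-bound (2 ℕ.+ n) (laterRows-bound (1 ℕ.+ n) (firstRow-bound n k<N))
block-bound {n} (inner t<M) = laterRows-bound (2 ℕ.+ n) (laterRows-bound (1 ℕ.+ n) (laterRows-bound n t<M))

half-double : ∀ p → ½ * (p + p) ≡ p
half-double p = trans (solve 2 (λ h p → h :* (p :+ p) := (h :+ h) :* p) refl ½ p) (ℚₚ.*-identityˡ p)

halve : ∀ {p q} → p + p ≡ q → p ≡ ½ * q
halve {p} p+p≡q = trans (sym (half-double p)) (cong (½ *_) p+p≡q)

half-sum : ∀ a b {p} → a + b ≡ p + p → ½ * a + ½ * b ≡ p
half-sum a b {p} a+b≡2p =
  trans (solve 3 (λ h a b → h :* a :+ h :* b := h :* (a :+ b)) refl ½ a b) (trans (cong (½ *_) a+b≡2p) (half-double p))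

+-cancelˡ-⇔ : ∀ a u v {c} → a + u ≡ c → (a + v ≡ c ⇔ u ≡ v)
+-cancelˡ-⇔ a u v a+u≡c =
  mk⇔ (λ a+v≡c → ∙-cancelˡ a u v (trans a+u≡c (sym a+v≡c))) (λ u≡v → trans (cong (a +_) (sym u≡v)) a+u≡c)

!-lookup : ∀ {n} (v : Vec ℚ n) {k} (k<n : k < n) → v ! suc k ≡ lookup v (fromℕ< k<n)
!-lookup {n} v {k} k<n with k ℕₚ.<? n
... | yes _  = refl
... | no k≮n = contradiction k<n k≮n

!-toℕ : ∀ {n} (v : Vec ℚ n) (i : Fin n) → v ! suc (toℕ i) ≡ lookup v i
!-toℕ v i = trans (!-lookup v (toℕ<n i)) (cong (lookup v) (fromℕ<-toℕ i (toℕ<n i)))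

AgreeOn : ℕ → (ℕ → ℚ) → (ℕ → ℚ) → Set
AgreeOn N x y = ∀ {i} → 1 ≤ i → i ≤ N → x i ≡ y i

DistinctOn : ℕ → (ℕ → ℚ) → Set
DistinctOn N x = ∀ {a b} → 1 ≤ a → a ≤ N → 1 ≤ b → b ≤ N → a ≢ b → x a ≢ x b

pairSum : (ℕ → ℚ) → ℕ × ℕ → ℚ
pairSum x (a , b) = x a + x b

PairEquations : (N : ℕ) → Vec ℚ (N C 2) → (ℕ → ℚ) → Set
PairEquations N ψ x = (k : ℕ) → 1 ≤ k → k ≤ N C 2 → pairSum x (pairAt N k) ≡ ψ ! k

!-ext : ∀ {N} {v w : Vec ℚ N} → AgreeOn N (v !_) (w !_) → v ≡ w
!-ext {v = v} {w} v≈w = begin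
  v                  ≡⟨ tabulate∘lookup v ⟨
  tabulate (lookup v) ≡⟨ tabulate-cong (λ i → trans (sym (!-toℕ v i)) (trans (v≈w (s≤s z≤n) (toℕ<n i)) (!-toℕ w i))) ⟩
  tabulate (lookup w) ≡⟨ tabulate∘lookup w ⟩
  w                  ∎
  where open ≡-Reasoning

formulaVec-agrees : ∀ N ψ → AgreeOn N (xFormula N ψ) (formulaVec N ψ !_)
formulaVec-agrees N ψ {suc k} _ k<N = sym (begin
  formulaVec N ψ ! suc k                    ≡⟨ !-lookup (formulaVec N ψ) k<N ⟩
  lookup (formulaVec N ψ) (fromℕ< k<N)      ≡⟨ lookup∘tabulate _ (fromℕ< k<N) ⟩
  xFormula N ψ (suc (toℕ (fromℕ< k<N)))     ≡⟨ cong (λ i → xFormula N ψ (suc i)) (toℕ-fromℕ< k<N) ⟩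
  xFormula N ψ (suc k)                      ∎)
  where open ≡-Reasoning

distinctOn-resp : ∀ {N x y} → AgreeOn N x y → DistinctOn N x → DistinctOn N y
distinctOn-resp x≈y distinct 1≤a a≤N 1≤b b≤N a≢b ya≡yb =
  distinct 1≤a a≤N 1≤b b≤N a≢b (trans (x≈y 1≤a a≤N) (trans ya≡yb (sym (x≈y 1≤b b≤N))))

pairEquations-resp : ∀ {N ψ x y} → AgreeOn N x y → PairEquations N ψ x → PairEquations N ψ y
pairEquations-resp {N} x≈y eqs (suc k) 1≤k k<M with pairAt-isPair N k<M
... | 1≤a , a<b , b≤N =
  trans (cong₂ _+_ (sym (x≈y 1≤a (ℕₚ.≤-trans (ℕₚ.<⇒≤ a<b) b≤N))) (sym (x≈y (ℕₚ.≤-trans 1≤a (ℕₚ.<⇒≤ a<b)) b≤N)))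
        (eqs (suc k) 1≤k k<M)

lookupDistinct⇒distinctOn : ∀ {N} (v : Vec ℚ N) →
  ((i j : Fin N) → i ≢ j → lookup v i ≢ lookup v j) → DistinctOn N (v !_)
lookupDistinct⇒distinctOn v distinct {suc a} {suc b} _ a<N _ b<N a≢b va≡vb =
  distinct (fromℕ< a<N) (fromℕ< b<N) (λ i≡j → a≢b (cong suc (fromℕ<-injective a b a<N b<N i≡j)))
    (trans (sym (!-lookup v a<N)) (trans va≡vb (!-lookup v b<N)))

distinctOn⇒lookupDistinct : ∀ {N} (v : Vec ℚ N) →
  DistinctOn N (v !_) → (i j : Fin N) → i ≢ j → lookup v i ≢ lookup v j
distinctOn⇒lookupDistinct v distinct i j i≢j vi≡vj =
  distinct (s≤s z≤n) (toℕ<n i) (s≤s z≤n) (toℕ<n j) (λ e → i≢j (toℕ-injective (ℕₚ.suc-injective e)))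
    (trans (!-toℕ v i) (trans vi≡vj (sym (!-toℕ v j))))

data Offset (a b : ℕ) : ℕ → Set where
  offset : ∀ {k} → k < b → Offset a b (a ℕ.+ suc k)

offsetView : ∀ a {b i} → suc a ≤ i → i ≤ a ℕ.+ b → Offset a b i
offsetView a {b} {i} a<i i≤a+b = subst (Offset a b) i≡a+[1+k] (offset k<b)
  where
  k = i ∸ suc a
  i≡a+[1+k] : a ℕ.+ suc k ≡ i
  i≡a+[1+k] = trans (ℕₚ.+-suc a k) (ℕₚ.m+[n∸m]≡n a<i)
  k<b : k < b
  k<b = ℕₚ.+-cancelˡ-≤ a (suc k) b (subst (_≤ a ℕ.+ b) (sym i≡a+[1+k]) i≤a+b)

4≤4+k : ∀ {k} → 4 ≤ 4 ℕ.+ k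
4≤4+k = s≤s (s≤s (s≤s (s≤s z≤n)))

∸-≡ : ∀ {a b c} → a ≡ b ℕ.+ c → a ∸ c ≡ b
∸-≡ {b = b} {c} a≡b+c = trans (cong (_∸ c) a≡b+c) (ℕₚ.m+n∸n≡m b c)

row₃-index : ∀ n k → (3 ℕ.+ n) ℕ.+ (n ℕ.+ suc k) ≡ suc ((2 ℕ.+ n) ℕ.+ ((1 ℕ.+ n) ℕ.+ k))
row₃-index = solve-∀

inner-index : ∀ n t → (3 ℕ.+ n) ℕ.+ ((n ℕ.+ n) ℕ.+ suc t) ≡ suc ((2 ℕ.+ n) ℕ.+ ((1 ℕ.+ n) ℕ.+ (n ℕ.+ t)))
inner-index = solve-∀

[n+1+k]+5∸[3+n]≡3+k : ∀ n k → (n ℕ.+ suc k) ℕ.+ 5 ∸ (3 ℕ.+ n) ≡ 3 ℕ.+ k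
[n+1+k]+5∸[3+n]≡3+k n k = ∸-≡ (lemma n k)
  where
  lemma : ∀ n k → (n ℕ.+ suc k) ℕ.+ 5 ≡ (3 ℕ.+ k) ℕ.+ (3 ℕ.+ n)
  lemma = solve-∀

[n+n+1+t]+6∸2[3+n]≡1+t : ∀ n t → ((n ℕ.+ n) ℕ.+ suc t) ℕ.+ 6 ∸ 2 ℕ.* (3 ℕ.+ n) ≡ suc t
[n+n+1+t]+6∸2[3+n]≡1+t n t = ∸-≡ (lemma n t)
  where
  lemma : ∀ n t → ((n ℕ.+ n) ℕ.+ suc t) ℕ.+ 6 ≡ suc t ℕ.+ 2 ℕ.* (3 ℕ.+ n)
  lemma = solve-∀

2[3+n]∸6≡n+n : ∀ n → 2 ℕ.* (3 ℕ.+ n) ∸ 6 ≡ n ℕ.+ n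
2[3+n]∸6≡n+n n = ∸-≡ (lemma n)
  where
  lemma : ∀ n → 2 ℕ.* (3 ℕ.+ n) ≡ (n ℕ.+ n) ℕ.+ 6
  lemma = solve-∀

2[3+n]∸5≡1+n+n : ∀ n → 2 ℕ.* (3 ℕ.+ n) ∸ 5 ≡ suc (n ℕ.+ n)
2[3+n]∸5≡1+n+n n = ∸-≡ (lemma n)
  where
  lemma : ∀ n → 2 ℕ.* (3 ℕ.+ n) ≡ suc (n ℕ.+ n) ℕ.+ 5
  lemma = solve-∀

[3+n]C2∸[3+n]≡n+n+nC2 : ∀ n → (3 ℕ.+ n) C 2 ∸ (3 ℕ.+ n) ≡ (n ℕ.+ n) ℕ.+ n C 2
[3+n]C2∸[3+n]≡n+n+nC2 n = ∸-≡ (trans [3+n]C2 (lemma n (n C 2)))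
  where
  [3+n]C2 : (3 ℕ.+ n) C 2 ≡ (2 ℕ.+ n) ℕ.+ ((1 ℕ.+ n) ℕ.+ (n ℕ.+ n C 2))
  [3+n]C2 = trans (suc-C2 (2 ℕ.+ n)) (cong ((2 ℕ.+ n) ℕ.+_) (trans (suc-C2 (1 ℕ.+ n)) (cong ((1 ℕ.+ n) ℕ.+_) (suc-C2 n))))
  lemma : ∀ n c → (2 ℕ.+ n) ℕ.+ ((1 ℕ.+ n) ℕ.+ (n ℕ.+ c)) ≡ ((n ℕ.+ n) ℕ.+ c) ℕ.+ (3 ℕ.+ n)
  lemma = solve-∀

module _ (n : ℕ) (ψ : Vec ℚ ((3 ℕ.+ n) C 2)) where
  private
    N : ℕ
    N = 3 ℕ.+ n

  record CoreEquations (x : ℕ → ℚ) : Set where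
    field
      pair₁₂ : x 1 + x 2 ≡ ψ ! 1
      pair₁₃ : x 1 + x 3 ≡ ψ ! 2
      pair₂₃ : x 2 + x 3 ≡ ψ ! N
      pair₁ⱼ : ∀ {j} → 4 ≤ j → j ≤ N → x 1 + x j ≡ ψ ! (j ∸ 1)

  Existence₁ Existence₂ Existence₃ : ℕ → Set
  Existence₁ i = ψ ! 2 + ψ ! (N ℕ.+ i) ≡ ψ ! N + ψ ! (i ℕ.+ 2)
  Existence₂ i = ψ ! 1 + ψ ! (N ℕ.+ i) ≡ ψ ! N + ψ ! (i ℕ.+ 5 ∸ N)
  Existence₃ i = ψ ! 1 + ψ ! 2 + ψ ! (N ℕ.+ i) ≡ ψ ! N + ψ ! (a ℕ.+ 2) + ψ ! (b ℕ.+ 2)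
    where
    t = i ℕ.+ 6 ∸ 2 ℕ.* N
    a = proj₁ (pairAt n t)
    b = proj₂ (pairAt n t)

  module _ {x : ℕ → ℚ} (core : CoreEquations x) where
    open CoreEquations core

    core-pair₂ⱼ : ∀ {j} → 4 ≤ j → j ≤ N → ψ ! 2 + (x 2 + x j) ≡ ψ ! N + ψ ! (j ∸ 1)
    core-pair₂ⱼ {j} 4≤j j≤N = begin
      ψ ! 2 + (x 2 + x j)       ≡⟨ cong (_+ (x 2 + x j)) pair₁₃ ⟨
      (x 1 + x 3) + (x 2 + x j) ≡⟨ solve 4 (λ a b c d → (a :+ c) :+ (b :+ d) := (b :+ c) :+ (a :+ d)) refl (x 1) (x 2) (x 3) (x j) ⟩
      (x 2 + x 3) + (x 1 + x j) ≡⟨ cong₂ _+_ pair₂₃ (pair₁ⱼ 4≤j j≤N) ⟩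
      ψ ! N + ψ ! (j ∸ 1)       ∎
      where open ≡-Reasoning

    core-pair₃ⱼ : ∀ {j} → 4 ≤ j → j ≤ N → ψ ! 1 + (x 3 + x j) ≡ ψ ! N + ψ ! (j ∸ 1)
    core-pair₃ⱼ {j} 4≤j j≤N = begin
      ψ ! 1 + (x 3 + x j)       ≡⟨ cong (_+ (x 3 + x j)) pair₁₂ ⟨
      (x 1 + x 2) + (x 3 + x j) ≡⟨ solve 4 (λ a b c d → (a :+ b) :+ (c :+ d) := (b :+ c) :+ (a :+ d)) refl (x 1) (x 2) (x 3) (x j) ⟩
      (x 2 + x 3) + (x 1 + x j) ≡⟨ cong₂ _+_ pair₂₃ (pair₁ⱼ 4≤j j≤N) ⟩
      ψ ! N + ψ ! (j ∸ 1)       ∎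
      where open ≡-Reasoning

    core-pairᵢⱼ : ∀ {i j} → 4 ≤ i → i ≤ N → 4 ≤ j → j ≤ N →
                  ψ ! 1 + ψ ! 2 + (x i + x j) ≡ ψ ! N + ψ ! (i ∸ 1) + ψ ! (j ∸ 1)
    core-pairᵢⱼ {i} {j} 4≤i i≤N 4≤j j≤N = begin
      ψ ! 1 + ψ ! 2 + (x i + x j)
        ≡⟨ cong (λ p → p + (x i + x j)) (cong₂ _+_ pair₁₂ pair₁₃) ⟨
      (x 1 + x 2) + (x 1 + x 3) + (x i + x j)
        ≡⟨ solve 5 (λ a b c d e → (a :+ b) :+ (a :+ c) :+ (d :+ e) := (b :+ c) :+ (a :+ d) :+ (a :+ e)) refl (x 1) (x 2) (x 3) (x i) (x j) ⟩
      (x 2 + x 3) + (x 1 + x i) + (x 1 + x j)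
        ≡⟨ cong₂ _+_ (cong₂ _+_ pair₂₃ (pair₁ⱼ 4≤i i≤N)) (pair₁ⱼ 4≤j j≤N) ⟩
      ψ ! N + ψ ! (i ∸ 1) + ψ ! (j ∸ 1)
        ∎
      where open ≡-Reasoning

    existence₁⇔pair₂ : ∀ {k} → k < n → Existence₁ (suc k) ⇔ (x 2 + x (4 ℕ.+ k) ≡ ψ ! (N ℕ.+ suc k))
    existence₁⇔pair₂ {k} k<n =
      +-cancelˡ-⇔ (ψ ! 2) (x 2 + x (4 ℕ.+ k)) (ψ ! (N ℕ.+ suc k))
        (trans (core-pair₂ⱼ 4≤4+k (s≤s (s≤s (s≤s k<n))))
               (cong (λ m → ψ ! N + ψ ! m) (ℕₚ.+-comm 2 (suc k))))

    existence₂⇔pair₃ : ∀ {k} → k < n → Existence₂ (n ℕ.+ suc k) ⇔ (x 3 + x (4 ℕ.+ k) ≡ ψ ! (N ℕ.+ (n ℕ.+ suc k)))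
    existence₂⇔pair₃ {k} k<n =
      +-cancelˡ-⇔ (ψ ! 1) (x 3 + x (4 ℕ.+ k)) (ψ ! (N ℕ.+ (n ℕ.+ suc k)))
        (trans (core-pair₃ⱼ 4≤4+k (s≤s (s≤s (s≤s k<n))))
               (cong (λ m → ψ ! N + ψ ! m) (sym ([n+1+k]+5∸[3+n]≡3+k n k))))

    existence₃⇔inner : ∀ {t} → t < n C 2 → let (a , b) = pairAt n (suc t) in
      Existence₃ ((n ℕ.+ n) ℕ.+ suc t) ⇔ (x (3 ℕ.+ a) + x (3 ℕ.+ b) ≡ ψ ! (N ℕ.+ ((n ℕ.+ n) ℕ.+ suc t)))
    existence₃⇔inner {t} t<M with pairAt-isPair n t<M
    ... | 1≤a , a<b , b≤n =
      +-cancelˡ-⇔ (ψ ! 1 + ψ ! 2) (x (3 ℕ.+ a) + x (3 ℕ.+ b)) (ψ ! (N ℕ.+ ((n ℕ.+ n) ℕ.+ suc t)))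
        (trans (core-pairᵢⱼ (s≤s (s≤s (s≤s 1≤a))) (s≤s (s≤s (s≤s (ℕₚ.≤-trans (ℕₚ.<⇒≤ a<b) b≤n))))
                            (s≤s (s≤s (s≤s (ℕₚ.≤-trans 1≤a (ℕₚ.<⇒≤ a<b))))) (s≤s (s≤s (s≤s b≤n))))
               (trans (cong₂ (λ p q → ψ ! N + ψ ! p + ψ ! q) (ℕₚ.+-comm 2 a) (ℕₚ.+-comm 2 b))
                      (cong rhs (sym ([n+n+1+t]+6∸2[3+n]≡1+t n t)))))
      where
      a = proj₁ (pairAt n (suc t))
      b = proj₂ (pairAt n (suc t))
      rhs : ℕ → ℚ
      rhs t = ψ ! N + ψ ! (proj₁ (pairAt n t) ℕ.+ 2) + ψ ! (proj₂ (pairAt n t) ℕ.+ 2)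

    blockEquation : ExistenceCondition N ψ → ∀ {k} (b : Block n k) → pairSum x (blockPair b) ≡ ψ ! suc k
    blockEquation _ (row₁ {zero} _)          = pair₁₂
    blockEquation _ (row₁ {suc zero} _)      = pair₁₃
    blockEquation _ (row₁ {suc (suc k)} k<N) = pair₁ⱼ 4≤4+k (s≤s k<N)
    blockEquation _ (row₂ {zero} _)          = trans pair₂₃ (cong (λ m → ψ ! suc m) (sym (ℕₚ.+-identityʳ (2 ℕ.+ n))))
    blockEquation (ec₁ , _) (row₂ {suc k} (s≤s k<n)) = to (existence₁⇔pair₂ k<n) (ec₁ (suc k) (s≤s z≤n) k<n)
    blockEquation (_ , ec₂ , _) (row₃ {k} k<n) =
      trans (to (existence₂⇔pair₃ k<n) (ec₂ (n ℕ.+ suc k) (ℕₚ.m<m+n n (s≤s z≤n)) i≤2N∸6)) (cong (ψ !_) (row₃-index n k))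
      where
      i≤2N∸6 = subst (n ℕ.+ suc k ≤_) (sym (2[3+n]∸6≡n+n n)) (ℕₚ.+-monoʳ-≤ n k<n)
    blockEquation (_ , _ , ec₃) (inner {t} t<M) =
      trans (to (existence₃⇔inner t<M) (ec₃ ((n ℕ.+ n) ℕ.+ suc t) 2N∸5≤i i≤M∸N)) (cong (ψ !_) (inner-index n t))
      where
      2N∸5≤i = subst (_≤ (n ℕ.+ n) ℕ.+ suc t) (sym (2[3+n]∸5≡1+n+n n)) (ℕₚ.m<m+n (n ℕ.+ n) (s≤s z≤n))
      i≤M∸N  = subst ((n ℕ.+ n) ℕ.+ suc t ≤_) (sym ([3+n]C2∸[3+n]≡n+n+nC2 n)) (ℕₚ.+-monoʳ-≤ (n ℕ.+ n) t<M)

    core+existence⇒pairs : ExistenceCondition N ψ → PairEquations N ψ x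
    core+existence⇒pairs ec (suc k) _ k<M =
      trans (cong (pairSum x) (pairAt-block b)) (blockEquation ec b)
      where b = block n k<M

    sharedSummand : ∀ {a b c p} → x a + x b ≡ p → x a + x c ≡ p → x b ≡ x c
    sharedSummand {a} {b} {c} e e′ = ∙-cancelˡ (x a) (x b) (x c) (trans e (sym e′))

    distinct⇒distinctCoordinates : DistinctOn N x → DistinctCoordinates N ψ
    distinct⇒distinctCoordinates distinct =
      ψ₁≢ψ₂ , ψ₁≢ψN , ψ₂≢ψN , ψᵢ≢ψⱼ , λ j 4≤j j≤N → ψ₁≢ψⱼ 4≤j j≤N , ψ₂≢ψⱼ 4≤j j≤N , ψ₁+ψ₂≢ψⱼ+ψN 4≤j j≤N
      where
      1≤ : ∀ {j} → 4 ≤ j → 1 ≤ j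
      1≤ = ℕₚ.≤-trans (s≤s z≤n)
      2≤N : 2 ≤ N
      2≤N = s≤s (s≤s z≤n)
      3≤N : 3 ≤ N
      3≤N = s≤s (s≤s (s≤s z≤n))
      ψ₁≢ψ₂ : ψ ! 1 ≢ ψ ! 2
      ψ₁≢ψ₂ e = distinct (s≤s z≤n) 2≤N (s≤s z≤n) 3≤N (λ ()) (sharedSummand pair₁₂ (trans pair₁₃ (sym e)))
      ψ₁≢ψN : ψ ! 1 ≢ ψ ! N
      ψ₁≢ψN e = distinct (s≤s z≤n) (s≤s z≤n) (s≤s z≤n) 3≤N (λ ())
        (sharedSummand (trans (ℚₚ.+-comm (x 2) (x 1)) (trans pair₁₂ e)) pair₂₃)
      ψ₂≢ψN : ψ ! 2 ≢ ψ ! N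
      ψ₂≢ψN e = distinct (s≤s z≤n) (s≤s z≤n) (s≤s z≤n) 2≤N (λ ())
        (sharedSummand (trans (ℚₚ.+-comm (x 3) (x 1)) (trans pair₁₃ e)) (trans (ℚₚ.+-comm (x 3) (x 2)) pair₂₃))
      ψᵢ≢ψⱼ : ∀ i j → 4 ≤ i → i < j → j ≤ N → ψ ! (i ∸ 1) ≢ ψ ! (j ∸ 1)
      ψᵢ≢ψⱼ i j 4≤i i<j j≤N e = distinct (1≤ 4≤i) i≤N (1≤ (ℕₚ.≤-trans 4≤i (ℕₚ.<⇒≤ i<j))) j≤N (ℕₚ.<⇒≢ i<j)
        (sharedSummand (pair₁ⱼ 4≤i i≤N) (trans (pair₁ⱼ (ℕₚ.≤-trans 4≤i (ℕₚ.<⇒≤ i<j)) j≤N) (sym e)))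
        where i≤N = ℕₚ.≤-trans (ℕₚ.<⇒≤ i<j) j≤N
      ψ₁≢ψⱼ : ∀ {j} → 4 ≤ j → j ≤ N → ψ ! 1 ≢ ψ ! (j ∸ 1)
      ψ₁≢ψⱼ 4≤j j≤N e = distinct (s≤s z≤n) 2≤N (1≤ 4≤j) j≤N (ℕₚ.<⇒≢ (ℕₚ.≤-trans (s≤s (s≤s (s≤s z≤n))) 4≤j))
        (sharedSummand pair₁₂ (trans (pair₁ⱼ 4≤j j≤N) (sym e)))
      ψ₂≢ψⱼ : ∀ {j} → 4 ≤ j → j ≤ N → ψ ! 2 ≢ ψ ! (j ∸ 1)
      ψ₂≢ψⱼ 4≤j j≤N e = distinct (s≤s z≤n) 3≤N (1≤ 4≤j) j≤N (ℕₚ.<⇒≢ 4≤j)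
        (sharedSummand pair₁₃ (trans (pair₁ⱼ 4≤j j≤N) (sym e)))
      ψ₁+ψ₂≢ψⱼ+ψN : ∀ {j} → 4 ≤ j → j ≤ N → ψ ! 1 + ψ ! 2 ≢ ψ ! (j ∸ 1) + ψ ! N
      ψ₁+ψ₂≢ψⱼ+ψN {j} 4≤j j≤N e = distinct (s≤s z≤n) (s≤s z≤n) (1≤ 4≤j) j≤N (ℕₚ.<⇒≢ (ℕₚ.≤-trans (s≤s (s≤s z≤n)) 4≤j))
        (∙-cancelˡ (x 1 + (x 2 + x 3)) (x 1) (x j) (begin
          (x 1 + (x 2 + x 3)) + x 1 ≡⟨ solve 3 (λ a b c → (a :+ (b :+ c)) :+ a := (a :+ b) :+ (a :+ c)) refl (x 1) (x 2) (x 3) ⟩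
          (x 1 + x 2) + (x 1 + x 3) ≡⟨ cong₂ _+_ pair₁₂ pair₁₃ ⟩
          ψ ! 1 + ψ ! 2             ≡⟨ e ⟩
          ψ ! (j ∸ 1) + ψ ! N       ≡⟨ cong₂ _+_ (pair₁ⱼ 4≤j j≤N) pair₂₃ ⟨
          (x 1 + x j) + (x 2 + x 3) ≡⟨ solve 4 (λ a b c d → (a :+ d) :+ (b :+ c) := (a :+ (b :+ c)) :+ d) refl (x 1) (x 2) (x 3) (x j) ⟩
          (x 1 + (x 2 + x 3)) + x j ∎))
        where open ≡-Reasoning

    distinctCoordinates⇒distinct-< : DistinctCoordinates N ψ → ∀ {a b} → 1 ≤ a → a < b → b ≤ N → x a ≢ x b
    distinctCoordinates⇒distinct-< _ {zero} () _ _
    distinctCoordinates⇒distinct-< _ {suc _} {0} _ () _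
    distinctCoordinates⇒distinct-< _ {suc _} {1} _ (s≤s ()) _
    distinctCoordinates⇒distinct-< _ {suc (suc _)} {2} _ (s≤s (s≤s ())) _
    distinctCoordinates⇒distinct-< _ {suc (suc (suc _))} {3} _ (s≤s (s≤s (s≤s ()))) _
    distinctCoordinates⇒distinct-< (_ , _ , ψ₂≢ψN , _) {1} {2} _ _ _ e =
      ψ₂≢ψN (trans (sym pair₁₃) (trans (cong (_+ x 3) e) pair₂₃))
    distinctCoordinates⇒distinct-< (_ , ψ₁≢ψN , _) {1} {3} _ _ _ e =
      ψ₁≢ψN (trans (sym pair₁₂) (trans (cong (_+ x 2) e) (trans (ℚₚ.+-comm (x 3) (x 2)) pair₂₃)))
    distinctCoordinates⇒distinct-< (ψ₁≢ψ₂ , _) {2} {3} _ _ _ e =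
      ψ₁≢ψ₂ (trans (sym pair₁₂) (trans (cong (x 1 +_) e) pair₁₃))
    distinctCoordinates⇒distinct-< (_ , _ , _ , _ , ψ≢ψⱼ) {1} {j@(suc (suc (suc (suc _))))} _ _ j≤N e =
      proj₂ (proj₂ (ψ≢ψⱼ j 4≤4+k j≤N)) (begin
        ψ ! 1 + ψ ! 2             ≡⟨ cong₂ _+_ pair₁₂ pair₁₃ ⟨
        (x 1 + x 2) + (x 1 + x 3) ≡⟨ solve 3 (λ a b c → (a :+ b) :+ (a :+ c) := (a :+ a) :+ (b :+ c)) refl (x 1) (x 2) (x 3) ⟩
        (x 1 + x 1) + (x 2 + x 3) ≡⟨ cong (λ y → (x 1 + y) + (x 2 + x 3)) e ⟩
        (x 1 + x j) + (x 2 + x 3) ≡⟨ cong₂ _+_ (pair₁ⱼ 4≤4+k j≤N) pair₂₃ ⟩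
        ψ ! (j ∸ 1) + ψ ! N       ∎)
      where open ≡-Reasoning
    distinctCoordinates⇒distinct-< (_ , _ , _ , _ , ψ≢ψⱼ) {2} {j@(suc (suc (suc (suc _))))} _ _ j≤N e =
      proj₁ (ψ≢ψⱼ j 4≤4+k j≤N) (trans (sym pair₁₂) (trans (cong (x 1 +_) e) (pair₁ⱼ 4≤4+k j≤N)))
    distinctCoordinates⇒distinct-< (_ , _ , _ , _ , ψ≢ψⱼ) {3} {j@(suc (suc (suc (suc _))))} _ _ j≤N e =
      proj₁ (proj₂ (ψ≢ψⱼ j 4≤4+k j≤N)) (trans (sym pair₁₃) (trans (cong (x 1 +_) e) (pair₁ⱼ 4≤4+k j≤N)))
    distinctCoordinates⇒distinct-< (_ , _ , _ , ψᵢ≢ψⱼ , _) {i@(suc (suc (suc (suc _))))} {j} _ i<j j≤N e =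
      ψᵢ≢ψⱼ i j 4≤4+k i<j j≤N
        (trans (sym (pair₁ⱼ 4≤4+k (ℕₚ.≤-trans (ℕₚ.<⇒≤ i<j) j≤N))) (trans (cong (x 1 +_) e) (pair₁ⱼ (ℕₚ.≤-trans 4≤4+k (ℕₚ.<⇒≤ i<j)) j≤N)))

    distinctCoordinates⇒distinct : DistinctCoordinates N ψ → DistinctOn N x
    distinctCoordinates⇒distinct dc {a} {b} 1≤a a≤N 1≤b b≤N a≢b with ℕₚ.<-cmp a b
    ... | tri< a<b _ _ = distinctCoordinates⇒distinct-< dc 1≤a a<b b≤N
    ... | tri≈ _ a≡b _ = contradiction a≡b a≢b
    ... | tri> _ _ b<a = distinctCoordinates⇒distinct-< dc 1≤b b<a a≤N ∘ sym

    core⇒formula : AgreeOn N x (xFormula N ψ)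
    core⇒formula {1} _ _ = halve (begin
      x 1 + x 1                               ≡⟨ solve 3 (λ a b c → a :+ a := (a :+ b) :+ (a :+ c) :- (b :+ c)) refl (x 1) (x 2) (x 3) ⟩
      (x 1 + x 2) + (x 1 + x 3) - (x 2 + x 3) ≡⟨ cong₂ _-_ (cong₂ _+_ pair₁₂ pair₁₃) pair₂₃ ⟩
      ψ ! 1 + ψ ! 2 - ψ ! N                   ∎)
      where open ≡-Reasoning
    core⇒formula {2} _ _ = halve (begin
      x 2 + x 2                               ≡⟨ solve 3 (λ a b c → b :+ b := (a :+ b) :- (a :+ c) :+ (b :+ c)) refl (x 1) (x 2) (x 3) ⟩
      (x 1 + x 2) - (x 1 + x 3) + (x 2 + x 3) ≡⟨ cong₂ _+_ (cong₂ _-_ pair₁₂ pair₁₃) pair₂₃ ⟩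
      ψ ! 1 - ψ ! 2 + ψ ! N                   ∎)
      where open ≡-Reasoning
    core⇒formula {3} _ _ = halve (begin
      x 3 + x 3                                 ≡⟨ solve 3 (λ a b c → c :+ c := (:- (a :+ b)) :+ (a :+ c) :+ (b :+ c)) refl (x 1) (x 2) (x 3) ⟩
      - (x 1 + x 2) + (x 1 + x 3) + (x 2 + x 3) ≡⟨ cong₂ _+_ (cong₂ _+_ (cong -_ pair₁₂) pair₁₃) pair₂₃ ⟩
      - ψ ! 1 + ψ ! 2 + ψ ! N                   ∎)
      where open ≡-Reasoning
    core⇒formula {j@(suc (suc (suc (suc _))))} _ j≤N = halve (begin
      x j + x j
        ≡⟨ solve 4 (λ a b c d → d :+ d := (:- (a :+ b)) :- (a :+ c) :+ ((a :+ d) :+ (a :+ d)) :+ (b :+ c)) refl (x 1) (x 2) (x 3) (x j) ⟩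
      - (x 1 + x 2) - (x 1 + x 3) + ((x 1 + x j) + (x 1 + x j)) + (x 2 + x 3)
        ≡⟨ cong₂ _+_ (cong₂ _+_ (cong₂ _-_ (cong -_ pair₁₂) pair₁₃) (cong₂ _+_ x₁+xⱼ x₁+xⱼ)) pair₂₃ ⟩
      - ψ ! 1 - ψ ! 2 + (ψ ! (j ∸ 1) + ψ ! (j ∸ 1)) + ψ ! N
        ∎)
      where
      open ≡-Reasoning
      x₁+xⱼ = pair₁ⱼ 4≤4+k j≤N

  formula-core : CoreEquations (xFormula N ψ)
  formula-core = record
    { pair₁₂ = half-sum x₁ x₂ (solve 3 (λ a b c → (a :+ b :- c) :+ (a :- b :+ c) := a :+ a) refl ψ₁ ψ₂ ψN)
    ; pair₁₃ = half-sum x₁ x₃ (solve 3 (λ a b c → (a :+ b :- c) :+ ((:- a) :+ b :+ c) := b :+ b) refl ψ₁ ψ₂ ψN)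
    ; pair₂₃ = half-sum x₂ x₃ (solve 3 (λ a b c → (a :- b :+ c) :+ ((:- a) :+ b :+ c) := c :+ c) refl ψ₁ ψ₂ ψN)
    ; pair₁ⱼ = pair₁ⱼ
    }
    where
    ψ₁ ψ₂ ψN x₁ x₂ x₃ : ℚ
    ψ₁ = ψ ! 1
    ψ₂ = ψ ! 2
    ψN = ψ ! N
    x₁ = ψ₁ + ψ₂ - ψN
    x₂ = ψ₁ - ψ₂ + ψN
    x₃ = - ψ₁ + ψ₂ + ψN
    pair₁ⱼ : ∀ {j} → 4 ≤ j → j ≤ N → xFormula N ψ 1 + xFormula N ψ j ≡ ψ ! (j ∸ 1)
    pair₁ⱼ {j} (s≤s (s≤s (s≤s (s≤s _)))) _ =
      half-sum x₁ (- ψ₁ - ψ₂ + (ψⱼ + ψⱼ) + ψN)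
        (solve 4 (λ a b c d → (a :+ b :- c) :+ ((:- a) :- b :+ (d :+ d) :+ c) := d :+ d) refl ψ₁ ψ₂ ψN ψⱼ)
      where ψⱼ = ψ ! (j ∸ 1)

  pairEquation-block : ∀ x {k} → PairEquations N ψ x → (b : Block n k) → pairSum x (blockPair b) ≡ ψ ! suc k
  pairEquation-block x eqs b = trans (cong (pairSum x) (sym (pairAt-block b))) (eqs _ (s≤s z≤n) (block-bound b))

  pairs⇒core : ∀ x → PairEquations N ψ x → CoreEquations x
  pairs⇒core x eqs = record
    { pair₁₂ = pairEquation-block x eqs (row₁ {k = 0} (s≤s z≤n))
    ; pair₁₃ = pairEquation-block x eqs (row₁ {k = 1} (s≤s (s≤s z≤n)))
    ; pair₂₃ = trans (pairEquation-block x eqs (row₂ {k = 0} (s≤s z≤n))) (cong (λ m → ψ ! suc m) (ℕₚ.+-identityʳ (2 ℕ.+ n)))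
    ; pair₁ⱼ = pair₁ⱼ
    }
    where
    pair₁ⱼ : ∀ {j} → 4 ≤ j → j ≤ N → x 1 + x j ≡ ψ ! (j ∸ 1)
    pair₁ⱼ (s≤s (s≤s (s≤s (s≤s _)))) j≤N = pairEquation-block x eqs (row₁ (s≤s⁻¹ j≤N))

  pairs⇒existence : ∀ x → PairEquations N ψ x → ExistenceCondition N ψ
  pairs⇒existence x eqs = ec₁ , ec₂ , ec₃
    where
    core = pairs⇒core x eqs
    ec₁ : ∀ i → 1 ≤ i → i ≤ n → Existence₁ i
    ec₁ (suc k) _ k<n = from (existence₁⇔pair₂ core k<n) (pairEquation-block x eqs (row₂ (s≤s k<n)))
    ec₂ : ∀ i → suc n ≤ i → i ≤ 2 ℕ.* N ∸ 6 → Existence₂ i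
    ec₂ i n<i i≤2N∸6 with offsetView n n<i (subst (i ≤_) (2[3+n]∸6≡n+n n) i≤2N∸6)
    ... | offset {k} k<n = from (existence₂⇔pair₃ core k<n)
                                (trans (pairEquation-block x eqs (row₃ k<n)) (cong (ψ !_) (sym (row₃-index n k))))
    ec₃ : ∀ i → 2 ℕ.* N ∸ 5 ≤ i → i ≤ N C 2 ∸ N → Existence₃ i
    ec₃ i 2N∸5≤i i≤M∸N
      with offsetView (n ℕ.+ n) (subst (_≤ i) (2[3+n]∸5≡1+n+n n) 2N∸5≤i) (subst (i ≤_) ([3+n]C2∸[3+n]≡n+n+nC2 n) i≤M∸N)
    ... | offset {t} t<M = from (existence₃⇔inner core t<M)
                                (trans (pairEquation-block x eqs (inner t<M)) (cong (ψ !_) (sym (inner-index n t))))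

  solution⇒conditions : ∀ {v} → IsSolution N ψ v → DistinctCoordinates N ψ × ExistenceCondition N ψ
  solution⇒conditions {v} (distinct , eqs) =
    distinct⇒distinctCoordinates (pairs⇒core (v !_) eqs) (lookupDistinct⇒distinctOn v distinct) ,
    pairs⇒existence (v !_) eqs

  formulaVec-solution : DistinctCoordinates N ψ → ExistenceCondition N ψ → IsSolution N ψ (formulaVec N ψ)
  formulaVec-solution dc ec =
    distinctOn⇒lookupDistinct (formulaVec N ψ) (distinctOn-resp agrees (distinctCoordinates⇒distinct formula-core dc)) ,
    pairEquations-resp agrees (core+existence⇒pairs formula-core ec)
    where agrees = formulaVec-agrees N ψ

  solution-unique : (v : Vec ℚ N) → IsSolution N ψ v → v ≡ formulaVec N ψ
  solution-unique v (_ , eqs) =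
    !-ext (λ 1≤i i≤N → trans (core⇒formula (pairs⇒core (v !_) eqs) 1≤i i≤N) (formulaVec-agrees N ψ 1≤i i≤N))

existenceCondition₃ : (ψ : Vec ℚ (3 C 2)) → ExistenceCondition 3 ψ
existenceCondition₃ ψ = (λ { (suc _) _ () }) , (λ { (suc _) _ () }) , (λ { (suc _) _ () })

module _ (ψ : Vec ℚ (2 C 2)) where
  private
    ψ₁ : ℚ
    ψ₁ = lookup ψ Fin.zero

  twoPoint : ℚ → Vec ℚ 2
  twoPoint s = s ∷ (ψ₁ - s) ∷ []

  twoPoint-solution : ∀ {s} → ψ₁ ⊔ 0ℚ ℚ.< s → IsSolution 2 ψ (twoPoint s)
  twoPoint-solution {s} ψ₁⊔0<s = distinct , equations
    where
    s≢ψ₁-s : s ≢ ψ₁ - s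
    s≢ψ₁-s s≡ψ₁-s = ℚₚ.<-irrefl refl (begin-strict
      ψ₁      ≡⟨ ℚₚ.+-identityʳ ψ₁ ⟨
      ψ₁ + 0ℚ <⟨ ℚₚ.+-mono-< (ℚₚ.≤-<-trans (ℚₚ.p≤p⊔q ψ₁ 0ℚ) ψ₁⊔0<s) (ℚₚ.≤-<-trans (ℚₚ.p≤q⊔p ψ₁ 0ℚ) ψ₁⊔0<s) ⟩
      s + s   ≡⟨ cong (s +_) s≡ψ₁-s ⟩
      s + (ψ₁ - s) ≡⟨ solve 2 (λ s p → s :+ (p :- s) := p) refl s ψ₁ ⟩
      ψ₁      ∎)
      where open ℚₚ.≤-Reasoning
    distinct : (i j : Fin 2) → i ≢ j → lookup (twoPoint s) i ≢ lookup (twoPoint s) j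
    distinct Fin.zero Fin.zero i≢j = contradiction refl i≢j
    distinct Fin.zero (Fin.suc Fin.zero) _ = s≢ψ₁-s
    distinct (Fin.suc Fin.zero) Fin.zero _ = s≢ψ₁-s ∘ sym
    distinct (Fin.suc Fin.zero) (Fin.suc Fin.zero) i≢j = contradiction refl i≢j
    equations : PairEquations 2 ψ (twoPoint s !_)
    equations (suc zero) _ _ = solve 2 (λ s p → s :+ (p :- s) := p) refl s ψ₁
    equations (suc (suc _)) _ (s≤s ())

  firstCoordinateBound : List (Vec ℚ 2) → ℚ
  firstCoordinateBound = foldr (λ v b → lookup v Fin.zero ⊔ b) (ψ₁ ⊔ 0ℚ)

  ψ₁⊔0≤firstCoordinateBound : ∀ L → ψ₁ ⊔ 0ℚ ℚ.≤ firstCoordinateBound L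
  ψ₁⊔0≤firstCoordinateBound []      = ℚₚ.≤-refl
  ψ₁⊔0≤firstCoordinateBound (v ∷ L) = ℚₚ.p≤q⇒p≤r⊔q (lookup v Fin.zero) (ψ₁⊔0≤firstCoordinateBound L)

  ∈⇒≤firstCoordinateBound : ∀ {v L} → v ∈ L → lookup v Fin.zero ℚ.≤ firstCoordinateBound L
  ∈⇒≤firstCoordinateBound {L = w ∷ L} (here refl) = ℚₚ.p≤p⊔q _ _
  ∈⇒≤firstCoordinateBound {L = w ∷ L} (there v∈L) = ℚₚ.p≤q⇒p≤r⊔q (lookup w Fin.zero) (∈⇒≤firstCoordinateBound v∈L)

  solution-avoiding : (L : List (Vec ℚ 2)) → Σ (Vec ℚ 2) λ v → IsSolution 2 ψ v × v ∉ L
  solution-avoiding L =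
    twoPoint s , twoPoint-solution (ℚₚ.≤-<-trans (ψ₁⊔0≤firstCoordinateBound L) B<s) ,
    λ s∈L → ℚₚ.<-irrefl refl (ℚₚ.≤-<-trans (∈⇒≤firstCoordinateBound s∈L) B<s)
    where
    B = firstCoordinateBound L
    s = 1ℚ + B
    B<s : B ℚ.< s
    B<s = subst (ℚ._< s) (ℚₚ.+-identityˡ B) (ℚₚ.+-monoˡ-< B (ℚₚ.positive⁻¹ 1ℚ))

theorem3p1 :
    -- (1) N = 2: infinitely many solutions (no finite list contains them all)
    ((ψ : Vec ℚ (2 C 2)) → AllInΨ ψ →
       (L : List (Vec ℚ 2)) → Σ (Vec ℚ 2) λ x → IsSolution 2 ψ x × x ∉ L)
    ×
    -- (2) N = 3: exactly one solution, given by the formula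
    ((ψ : Vec ℚ (3 C 2)) → AllInΨ ψ → DistinctCoordinates 3 ψ →
       IsSolution 3 ψ (formulaVec 3 ψ) ×
       ((x : Vec ℚ 3) → IsSolution 3 ψ x → x ≡ formulaVec 3 ψ))
    ×
    -- (3) N ≥ 4: existence iff both conditions; then unique, given by the formula
    ((N : ℕ) → 4 ≤ N → (ψ : Vec ℚ (N C 2)) → AllInΨ ψ →
       ((∃ λ x → IsSolution N ψ x) ⇔
          (DistinctCoordinates N ψ × ExistenceCondition N ψ)) ×
       (DistinctCoordinates N ψ × ExistenceCondition N ψ →
          IsSolution N ψ (formulaVec N ψ) ×
          ((x : Vec ℚ N) → IsSolution N ψ x → x ≡ formulaVec N ψ)))
theorem3p1 =
  (λ ψ _ → solution-avoiding ψ) ,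
  (λ ψ _ dc → formulaVec-solution 0 ψ dc (existenceCondition₃ ψ) , solution-unique 0 ψ) ,
  λ { (suc (suc (suc n))) (s≤s (s≤s (s≤s _))) ψ _ →
        mk⇔ (λ (v , sol) → solution⇒conditions n ψ sol) (λ (dc , ec) → _ , formulaVec-solution n ψ dc ec) ,
        λ (dc , ec) → formulaVec-solution n ψ dc ec , solution-unique n ψ }
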